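{- Let $X$ and $Y$ be complex-valued functions on pairs of positive integers. Then $$Y(m,t)=\sum_{d\mid\gcd(m,t)}(-1)^{t(d+1)/d}\frac md X\!\left(\frac md,\frac td\right)\ \text{for all positive integers } m,t$$ holds if and only if $$X(m,t)=\frac1m\sum_{d\mid\gcd(m,t)}(-1)^{t(d+1)/d}\mu(d)\,Y\!\left(\frac md,\frac td\right)\ \text{for all positive integers } m,t.$$
   Context: $\mu$ is the Möbius function. -}

module Defs where

open import Level using (Level)
open import Data.Nat using (ℕ; zero; suc; NonZero) renaming (_*_ to _*ℕ_)
open import Data.Nat.DivMod using (_/_)
open import Data.Nat.GCD using (gcd)
open import Data.Nat.Divisibility using (_∣_; _∣?_)
open import Data.Nat.Primality using (prime?)
open import Data.Integer using (ℤ; +_; -[1+_])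
open import Data.List using (List; upTo; filter; length; map; foldr)
open import Data.Bool.ListAction using (and)
open import Data.Bool using (Bool; if_then_else_)
open import Relation.Nullary.Decidable using (_×-dec_; ⌊_⌋; ¬?)
open import Algebra.Bundles using (CommutativeRing)

squarefree : ℕ → Bool
squarefree n = and (map (λ k → ⌊ ¬? ((suc (suc k) *ℕ suc (suc k)) ∣? n) ⌋) (upTo n))

ω : ℕ → ℕ
ω n = length (filter (λ p → prime? p ×-dec (p ∣? n)) (upTo (suc n)))

negOnePowℤ : ℕ → ℤ
negOnePowℤ zero = + 1
negOnePowℤ (suc zero) = -[1+ 0 ]
negOnePowℤ (suc (suc k)) = negOnePowℤ k

μ : ℕ → ℤ
μ n = if squarefree n then negOnePowℤ (ω n) else + 0

module _ {c ℓ : Level} (R : CommutativeRing c ℓ) where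
  open CommutativeRing R

  fromℕ : ℕ → Carrier
  fromℕ zero = 0#
  fromℕ (suc n) = 1# + fromℕ n

  fromℤ : ℤ → Carrier
  fromℤ (+ n) = fromℕ n
  fromℤ -[1+ n ] = - fromℕ (suc n)

  negOnePow : ℕ → Carrier
  negOnePow zero = 1#
  negOnePow (suc n) = - negOnePow n

  -- Σ_{d ∣ n, 1 ≤ d ≤ n} f d   (for n ≥ 1 this is the sum over all divisors of n)
  sumDivisors : ℕ → ((d : ℕ) → .{{_ : NonZero d}} → Carrier) → Carrier
  sumDivisors n f = foldr _+_ 0#
    (map (λ k → f (suc k)) (filter (λ k → suc k ∣? n) (upTo n)))

  -- exponent t(d+1)/d, computed as (t/d)·(d+1)
  signExp : (t d : ℕ) → .{{_ : NonZero d}} → ℕ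
  signExp t d = (t / d) *ℕ suc d

  transformY : (ℕ → ℕ → Carrier) → ℕ → ℕ → Carrier
  transformY X m t = sumDivisors (gcd m t) (λ d →
    negOnePow (signExp t d) * (fromℕ (m / d) * X (m / d) (t / d)))

  transformX : (ℕ → ℕ → Carrier) → ℕ → ℕ → Carrier
  transformX Y m t = sumDivisors (gcd m t) (λ d →
    negOnePow (signExp t d) * (fromℤ (μ d) * Y (m / d) (t / d)))

module Submission where

-- Put Z(m,t) = m·X(m,t) and ε(t,d) = (-1)^{t(d+1)/d}.  For a weight f on
-- the positive integers let  twisted f Z (m,t) = Σ_{d ∣ gcd(m,t)} ε(t,d) f(d) Z(m/d,t/d), and
-- let plain Z be the same sum without weight.  Then the first relation says Y = plain Z and
-- the second says m·X = twisted μ Y (both definitionally, on positive arguments).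
--   * Since ε(t,d) ε(t/d,e) = ε(t,de), regrouping the double sum by K = de gives
--     twisted f (plain Z) = twisted (f ⋆ 1) Z with (f ⋆ 1)(K) = Σ_{d ∣ K} f(d).
--   * Σ_{d ∣ n} μ(d) is 1 for n = 1 and 0 for n ≥ 2 (split the divisors of n = q·p, p prime,
--     by divisibility by p, using μ(p·e) = -[p ∤ e] μ(e)); hence twisted μ (plain Z) = Z.
--   * If f(1) = 1 then twisted f is unitriangular in m, hence injective (strong induction).
-- The theorem follows: Y = plain Z gives twisted μ Y = Z, and conversely twisted μ Y = Z
-- = twisted μ (plain Z) gives Y = plain Z by injectivity.

open import Defs
open import Data.Nat as ℕ using (ℕ; zero; suc; pred; _≤_; _<_; z≤n; s≤s; z<s; s<s; NonZero; _≟_)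
  renaming (_+_ to _+ℕ_; _*_ to _*ℕ_)
import Data.Nat.Properties as ℕ
open import Data.Nat.Divisibility
  using (_∣_; _∣?_; 1∣_; ∣-refl; ∣-trans; ∣⇒≤; ∣n⇒∣m*n; ∣m⇒∣m*n; m∣m*n; *-pres-∣; *-monoʳ-∣; *-monoˡ-∣; *-cancelˡ-∣;
         ∣m+n∣m⇒∣n; ∣m∣n⇒∣m+n)
open import Data.Nat.Primality
  using (Prime; prime?; euclidsLemma; prime⇒irreducible; prime⇒nonZero; productOfPrimes≢0)
open import Data.Nat.Primality.Factorisation using (factorise)
open import Data.Nat.ListAction using (product)
open import Data.Nat.DivMod using (_/_; n/1≡n; m/n*n≡m; m*n/n≡m; m/n/o≡m/[n*o]; m/n<m; m≥n⇒m/n>0)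
open import Data.Nat.GCD using (gcd; gcd[m,n]∣m; gcd[m,n]∣n; gcd[m,n]≢0; gcd[cm,cn]/c≡gcd[m,n])
open import Data.Nat.Tactic.RingSolver using (solve-∀)
open import Data.Nat.Induction using (<-rec)
open import Data.Nat.Coprimality using (Coprime; coprime-divisor)
open import Data.Integer as ℤ using (ℤ; +_; -[1+_])
open import Data.Bool using (Bool; true; false; T; if_then_else_)
open import Data.Fin using (Fin; toℕ)
open import Data.List using ([]; _∷_; applyUpTo; upTo; filter; map; foldr; length)
open import Data.List.Relation.Unary.All using (_∷_)
open import Data.List.Relation.Unary.All.Properties using (all⁺; all⁻; applyUpTo⁺₁; applyUpTo⁻)
open import Data.Product using (_×_; _,_)
open import Data.Sum using (_⊎_; inj₁; inj₂)
open import Data.Empty using (⊥-elim)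
open import Function using (_∘_)
open import Relation.Nullary using (Dec; yes; no; ¬_; ¬?; contradiction)
open import Relation.Nullary.Decidable using (_×-dec_; toWitness; fromWitness)
open import Relation.Unary using (Pred; Decidable)
open import Relation.Binary.PropositionalEquality as ≡ using (_≡_; _≢_)
open import Algebra.Bundles using (CommutativeSemiring; CommutativeRing)
open import Function.Bundles using (_⇔_; mk⇔)

module FiniteSums {c ℓ} (S : CommutativeSemiring c ℓ) where
  open CommutativeSemiring S
  open import Algebra.Properties.Semiring.Sum semiring
    using (sum; ∑-distrib-+; ∑-comm; *-distribˡ-sum)

  Σ : ℕ → (ℕ → Carrier) → Carrier
  Σ n f = sum (λ (i : Fin n) → f (toℕ i))

  Σ-cong : ∀ n {f g} → (∀ i → i < n → f i ≈ g i) → Σ n f ≈ Σ n g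
  Σ-cong zero    f≈g = refl
  Σ-cong (suc n) f≈g = +-cong (f≈g 0 z<s) (Σ-cong n (λ i i<n → f≈g (suc i) (s<s i<n)))

  Σ-zero : ∀ n {f} → (∀ i → i < n → f i ≈ 0#) → Σ n f ≈ 0#
  Σ-zero zero    f≈0 = refl
  Σ-zero (suc n) f≈0 =
    trans (+-cong (f≈0 0 z<s) (Σ-zero n (λ i i<n → f≈0 (suc i) (s<s i<n)))) (+-identityˡ 0#)

  Σ-+ : ∀ n f g → Σ n (λ i → f i + g i) ≈ Σ n f + Σ n g
  Σ-+ n f g = ∑-distrib-+ (λ (i : Fin n) → f (toℕ i)) (λ i → g (toℕ i))

  Σ-swap : ∀ n k (F : ℕ → ℕ → Carrier) → Σ n (λ i → Σ k (F i)) ≈ Σ k (λ j → Σ n (λ i → F i j))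
  Σ-swap n k F = ∑-comm (λ (i : Fin n) (j : Fin k) → F (toℕ i) (toℕ j))

  Σ-*ˡ : ∀ n x f → x * Σ n f ≈ Σ n (λ i → x * f i)
  Σ-*ˡ n x f = *-distribˡ-sum x (λ (i : Fin n) → f (toℕ i))

  Σ-split : ∀ a b f → Σ (a +ℕ b) f ≈ Σ a f + Σ b (λ i → f (a +ℕ i))
  Σ-split zero    b f = sym (+-identityˡ _)
  Σ-split (suc a) b f = trans (+-congˡ (Σ-split a b (λ i → f (suc i)))) (sym (+-assoc _ _ _))

  Σ-truncate : ∀ n N f → n ≤ N → (∀ i → n ≤ i → i < N → f i ≈ 0#) → Σ N f ≈ Σ n f
  Σ-truncate zero    N       f _         f≈0 = Σ-zero N (λ i i<N → f≈0 i z≤n i<N)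
  Σ-truncate (suc n) (suc N) f (s≤s n≤N) f≈0 =
    +-congˡ (Σ-truncate n N (λ i → f (suc i)) n≤N (λ i n≤i i<N → f≈0 (suc i) (s≤s n≤i) (s<s i<N)))

  Σ-single : ∀ n f j → j < n → (∀ i → i < n → i ≢ j → f i ≈ 0#) → Σ n f ≈ f j
  Σ-single (suc n) f zero _ f≈0 =
    trans (+-congˡ (Σ-zero n (λ i i<n → f≈0 (suc i) (s<s i<n) (λ ())))) (+-identityʳ _)
  Σ-single (suc n) f (suc j) (s<s j<n) f≈0 =
    trans (+-congʳ (f≈0 0 z<s (λ ())))
      (trans (+-identityˡ _) (Σ-single n (λ i → f (suc i)) j j<n
        (λ i i<n i≢j → f≈0 (suc i) (s<s i<n) (i≢j ∘ ℕ.suc-injective))))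

  [_] : ∀ {p} {P : Set p} → Dec P → Carrier
  [ yes _ ] = 1#
  [ no _ ]  = 0#

  module _ {p} {P : Set p} where

    [yes]* : (P? : Dec P) → P → ∀ x → [ P? ] * x ≈ x
    [yes]* (yes _) _  x = *-identityˡ x
    [yes]* (no ¬P) pf x = ⊥-elim (¬P pf)

    [no]* : (P? : Dec P) → ¬ P → ∀ x → [ P? ] * x ≈ 0#
    [no]* (yes pf) ¬P x = ⊥-elim (¬P pf)
    [no]* (no _)   _  x = zeroˡ x

    []-cong : ∀ {q} {Q : Set q} (P? : Dec P) (Q? : Dec Q) → (P → Q) → (Q → P) → [ P? ] ≈ [ Q? ]
    []-cong (yes _) (yes _) _ _ = refl
    []-cong (no _)  (no _)  _ _ = refl
    []-cong (yes pf) (no ¬Q) to _ = ⊥-elim (¬Q (to pf))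
    []-cong (no ¬P) (yes q) _ from = ⊥-elim (¬P (from q))

    []*-cong : (P? : Dec P) {x y : Carrier} → (P → x ≈ y) → [ P? ] * x ≈ [ P? ] * y
    []*-cong (yes pf) x≈y = *-congˡ (x≈y pf)
    []*-cong (no _)   _   = trans (zeroˡ _) (sym (zeroˡ _))

    []-split : (P? : Dec P) → ∀ x → x ≈ [ P? ] * x + [ ¬? P? ] * x
    []-split (yes _) x = sym (trans (+-cong (*-identityˡ x) (zeroˡ x)) (+-identityʳ x))
    []-split (no _)  x = sym (trans (+-cong (zeroˡ x) (*-identityˡ x)) (+-identityˡ x))

  []-⊎ : ∀ {p q r} {P : Set p} {Q : Set q} {R : Set r} (P? : Dec P) (Q? : Dec Q) (R? : Dec R) →
    (P → Q ⊎ R) → (Q ⊎ R → P) → (Q → ¬ R) → [ P? ] ≈ [ Q? ] + [ R? ]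
  []-⊎ (yes _)  (yes q)  (yes r)  _  _    excl = ⊥-elim (excl q r)
  []-⊎ (yes _)  (yes _)  (no _)   _  _    _    = sym (+-identityʳ 1#)
  []-⊎ (yes _)  (no _)   (yes _)  _  _    _    = sym (+-identityˡ 1#)
  []-⊎ (yes pf) (no ¬Q)  (no ¬R)  to _    _    with to pf
  ... | inj₁ q = ⊥-elim (¬Q q)
  ... | inj₂ r = ⊥-elim (¬R r)
  []-⊎ (no ¬P)  (yes q)  _        _  from _    = ⊥-elim (¬P (from (inj₁ q)))
  []-⊎ (no ¬P)  (no _)   (yes r)  _  from _    = ⊥-elim (¬P (from (inj₂ r)))
  []-⊎ (no _)   (no _)   (no _)   _  _    _    = sym (+-identityˡ 0#)

  foldr-filter : ∀ {p} {P : Pred ℕ p} (P? : Decidable P) (g : ℕ → Carrier) h n →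
    foldr _+_ 0# (map g (filter P? (applyUpTo h n))) ≈ Σ n (λ i → [ P? (h i) ] * g (h i))
  foldr-filter P? g h zero = refl
  foldr-filter P? g h (suc n) with P? (h 0)
  ... | yes _ = +-cong (sym (*-identityˡ _)) (foldr-filter P? g (λ i → h (suc i)) n)
  ... | no _  = trans (foldr-filter P? g (λ i → h (suc i)) n)
                  (sym (trans (+-congʳ (zeroˡ _)) (+-identityˡ _)))

-- k² for k ≥ 2, written as in the definition of `squarefree`
square₂₊ : ℕ → ℕ
square₂₊ k = suc (suc k) *ℕ suc (suc k)

SquareFree : ℕ → Set
SquareFree n = ∀ k → ¬ square₂₊ k ∣ n

-- `squarefree` only inspects k ≤ n, which suffices since k² > n for larger k
squarefree-sound : ∀ n .{{_ : NonZero n}} → T (squarefree n) → SquareFree n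
squarefree-sound n sf k k²∣n =
  toWitness (applyUpTo⁻ (λ i → i) n (all⁺ _ (upTo n) sf) k<n) k²∣n
  where
  k<n : k < n
  k<n = ℕ.<-≤-trans (ℕ.≤-trans (ℕ.n≤1+n (suc k)) (ℕ.m≤m*n (suc (suc k)) (suc (suc k)))) (∣⇒≤ k²∣n)

squarefree-complete : ∀ n → SquareFree n → T (squarefree n)
squarefree-complete n sf = all⁻ _ (applyUpTo⁺₁ (λ i → i) n (λ {k} _ → fromWitness (sf k)))

T-ext : ∀ {a b : Bool} → (T a → T b) → (T b → T a) → a ≡ b
T-ext {false} {false} _ _ = ≡.refl
T-ext {false} {true}  _ g = ⊥-elim (g _)
T-ext {true}  {false} f _ = ⊥-elim (f _)
T-ext {true}  {true}  _ _ = ≡.refl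

prime-coprime-square : ∀ {p x} → Prime p → ¬ p ∣ x → Coprime (x *ℕ x) p
prime-coprime-square {p} {x} pp p∤x {i} (i∣x² , i∣p) with prime⇒irreducible pp i∣p
... | inj₁ i≡1 = i≡1
... | inj₂ ≡.refl with euclidsLemma x x pp i∣x²
...   | inj₁ p∣x = contradiction p∣x p∤x
...   | inj₂ p∣x = contradiction p∣x p∤x

square-∣-prime-mul : ∀ {p n} x → Prime p → ¬ p ∣ n → x *ℕ x ∣ p *ℕ n → x *ℕ x ∣ n
square-∣-prime-mul {p} {n} x pp p∤n x²∣pn with p ∣? x
... | no p∤x = coprime-divisor (prime-coprime-square pp p∤x) x²∣pn
... | yes p∣x = contradiction (*-cancelˡ-∣ p p²∣pn) p∤n
  where
  instance _ = prime⇒nonZero pp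
  p²∣pn : p *ℕ p ∣ p *ℕ n
  p²∣pn = ∣-trans (*-pres-∣ p∣x p∣x) x²∣pn

squarefree-prime-mul : ∀ {p} n .{{_ : NonZero n}} → Prime p → ¬ p ∣ n →
  squarefree (p *ℕ n) ≡ squarefree n
squarefree-prime-mul {p} n pp p∤n = T-ext
  (λ sf → squarefree-complete n λ k k²∣n →
    squarefree-sound (p *ℕ n) sf k (∣n⇒∣m*n p k²∣n))
  (λ sf → squarefree-complete (p *ℕ n) λ k k²∣pn →
    squarefree-sound n sf k (square-∣-prime-mul (suc (suc k)) pp p∤n k²∣pn))
  where instance _ = prime⇒nonZero pp
                 _ = ℕ.m*n≢0 p n

squarefree-prime-mul-∣ : ∀ {p} n .{{_ : NonZero n}} → Prime p → p ∣ n →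
  squarefree (p *ℕ n) ≡ false
squarefree-prime-mul-∣ {p@(suc (suc k))} n pp p∣n = ≡.sym (T-ext (λ ())
  (λ sf → squarefree-sound (p *ℕ n) sf k (*-pres-∣ (∣-refl {p}) p∣n)))
  where instance _ = ℕ.m*n≢0 p n

module PrimeDivisorCounting where
  open FiniteSums ℕ.+-*-commutativeSemiring
    using ([_]; []-⊎; Σ-cong; Σ-+; Σ-truncate; Σ-single)
    renaming (Σ to Σℕ)

  length-filter : ∀ {p} {P : Pred ℕ p} (P? : Decidable P) h n →
    length (filter P? (applyUpTo h n)) ≡ Σℕ n (λ i → [ P? (h i) ])
  length-filter P? h zero = ≡.refl
  length-filter P? h (suc n) with P? (h 0)
  ... | yes _ = ≡.cong suc (length-filter P? (λ i → h (suc i)) n)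
  ... | no _  = length-filter P? (λ i → h (suc i)) n

  PrimeDivisorOf : ℕ → Pred ℕ _
  PrimeDivisorOf n i = Prime i × i ∣ n

  primeDivisorOf? : ∀ n → Decidable (PrimeDivisorOf n)
  primeDivisorOf? n i = prime? i ×-dec i ∣? n

  ω-Σ : ∀ n → ω n ≡ Σℕ (suc n) (λ i → [ primeDivisorOf? n i ])
  ω-Σ n = length-filter (primeDivisorOf? n) (λ i → i) (suc n)

  primeDivisor-prime-mul : ∀ {p n i} → Prime p → ¬ p ∣ n →
    PrimeDivisorOf (p *ℕ n) i → PrimeDivisorOf n i ⊎ i ≡ p
  primeDivisor-prime-mul {p} {n} {i} pp p∤n (pi , i∣pn) with euclidsLemma p n pi i∣pn
  ... | inj₂ i∣n = inj₁ (pi , i∣n)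
  ... | inj₁ i∣p with prime⇒irreducible pp i∣p
  ...   | inj₂ i≡p = inj₂ i≡p
  ...   | inj₁ ≡.refl with pi
  ...     | ()

  ω-prime-mul : ∀ {p} n .{{_ : NonZero n}} → Prime p → ¬ p ∣ n → ω (p *ℕ n) ≡ suc (ω n)
  ω-prime-mul {p} n pp p∤n = begin
    ω (p *ℕ n)                                                   ≡⟨ ω-Σ (p *ℕ n) ⟩
    Σℕ N (λ i → [ primeDivisorOf? (p *ℕ n) i ])                   ≡⟨ Σ-cong N (λ i _ → split i) ⟩
    Σℕ N (λ i → [ primeDivisorOf? n i ] +ℕ [ i ≟ p ])             ≡⟨ Σ-+ N (λ i → [ primeDivisorOf? n i ]) (λ i → [ i ≟ p ]) ⟩
    Σℕ N (λ i → [ primeDivisorOf? n i ]) +ℕ Σℕ N (λ i → [ i ≟ p ])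
      ≡⟨ ≡.cong₂ _+ℕ_ (Σ-truncate (suc n) N (λ i → [ primeDivisorOf? n i ]) n<N beyond-n)
                      (Σ-single N (λ i → [ i ≟ p ]) p p<N (λ i _ → ≢p i)) ⟩
    Σℕ (suc n) (λ i → [ primeDivisorOf? n i ]) +ℕ [ p ≟ p ]       ≡⟨ ≡.cong₂ _+ℕ_ (≡.sym (ω-Σ n)) (≡p p) ⟩
    ω n +ℕ 1                                                      ≡⟨ ℕ.+-comm (ω n) 1 ⟩
    suc (ω n)                                                     ∎
    where
    open ≡.≡-Reasoning
    instance _ = prime⇒nonZero pp
    N = suc (p *ℕ n)
    n<N : suc n ≤ N
    n<N = s≤s (ℕ.m≤n*m n p)
    p<N : p < N
    p<N = s≤s (ℕ.m≤m*n p n)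
    split : ∀ i → [ primeDivisorOf? (p *ℕ n) i ] ≡ [ primeDivisorOf? n i ] +ℕ [ i ≟ p ]
    split i = []-⊎ (primeDivisorOf? (p *ℕ n) i) (primeDivisorOf? n i) (i ≟ p)
      (primeDivisor-prime-mul pp p∤n)
      (λ { (inj₁ (pi , i∣n)) → pi , ∣n⇒∣m*n p i∣n ; (inj₂ ≡.refl) → pp , m∣m*n n })
      (λ { (_ , i∣n) ≡.refl → p∤n i∣n })
    beyond-n : ∀ i → suc n ≤ i → i < N → [ primeDivisorOf? n i ] ≡ 0
    beyond-n i n<i _ with primeDivisorOf? n i
    ... | yes (_ , i∣n) = contradiction (∣⇒≤ i∣n) (ℕ.<⇒≱ n<i)
    ... | no _          = ≡.refl
    ≢p : ∀ i → i ≢ p → [ i ≟ p ] ≡ 0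
    ≢p i i≢p with i ≟ p
    ... | yes i≡p = contradiction i≡p i≢p
    ... | no _    = ≡.refl
    ≡p : ∀ i → [ i ≟ i ] ≡ 1
    ≡p i with i ≟ i
    ... | yes _   = ≡.refl
    ... | no i≢i  = contradiction ≡.refl i≢i

open PrimeDivisorCounting using (ω-prime-mul)

negOnePowℤ-suc : ∀ k → negOnePowℤ (suc k) ≡ ℤ.- negOnePowℤ k
negOnePowℤ-suc zero          = ≡.refl
negOnePowℤ-suc (suc zero)    = ≡.refl
negOnePowℤ-suc (suc (suc k)) = negOnePowℤ-suc k

μ-prime-mul : ∀ {p} n .{{_ : NonZero n}} → Prime p → ¬ p ∣ n → μ (p *ℕ n) ≡ ℤ.- μ n
μ-prime-mul {p} n pp p∤n = begin
  μ (p *ℕ n)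
    ≡⟨ ≡.cong₂ (λ b w → if b then negOnePowℤ w else + 0)
         (squarefree-prime-mul n pp p∤n) (ω-prime-mul n pp p∤n) ⟩
  (if squarefree n then negOnePowℤ (suc (ω n)) else + 0)
    ≡⟨ negate-if (squarefree n) ⟩
  ℤ.- μ n ∎
  where
  open ≡.≡-Reasoning
  negate-if : ∀ b → (if b then negOnePowℤ (suc (ω n)) else + 0)
                  ≡ ℤ.- (if b then negOnePowℤ (ω n) else + 0)
  negate-if true  = negOnePowℤ-suc (ω n)
  negate-if false = ≡.refl

μ-prime-mul-∣ : ∀ {p} n .{{_ : NonZero n}} → Prime p → p ∣ n → μ (p *ℕ n) ≡ + 0
μ-prime-mul-∣ {p} n pp p∣n =
  ≡.cong (λ b → if b then negOnePowℤ (ω (p *ℕ n)) else + 0) (squarefree-prime-mul-∣ n pp p∣n)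

/-factor : ∀ t d e .{{_ : NonZero d}} .{{_ : NonZero e}} → d *ℕ e ∣ t →
  t / d ≡ _/_ t (d *ℕ e) {{ℕ.m*n≢0 d e}} *ℕ e
/-factor t d e de∣t = begin
  t / d                 ≡⟨ ≡.cong (_/ d) (m/n*n≡m de∣t) ⟨
  u *ℕ (d *ℕ e) / d     ≡⟨ ≡.cong (_/ d) (reassociate u d e) ⟩
  (u *ℕ e) *ℕ d / d     ≡⟨ m*n/n≡m (u *ℕ e) d ⟩
  u *ℕ e                ∎
  where
  open ≡.≡-Reasoning
  instance _ = ℕ.m*n≢0 d e
  u = t / (d *ℕ e)
  reassociate : ∀ u d e → u *ℕ (d *ℕ e) ≡ (u *ℕ e) *ℕ d
  reassociate = solve-∀

gcd-nonZero : ∀ m t .{{_ : NonZero m}} → NonZero (gcd m t)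
gcd-nonZero m t = ℕ.≢-nonZero (gcd[m,n]≢0 m t (inj₁ (ℕ.≢-nonZero⁻¹ m)))

/-positive : ∀ n d .{{_ : NonZero d}} → 1 ≤ n → d ∣ n → 1 ≤ n / d
/-positive n d 1≤n d∣n = m≥n⇒m/n>0 (∣⇒≤ d∣n)
  where instance _ = ℕ.>-nonZero 1≤n

gcd-/ : ∀ m t d .{{_ : NonZero d}} → d ∣ m → d ∣ t → gcd (m / d) (t / d) ≡ gcd m t / d
gcd-/ m t d d∣m d∣t = ≡.sym (≡.trans
  (≡.cong₂ (λ a b → gcd a b / d) (≡.sym (d*[n/d]≡n d∣m)) (≡.sym (d*[n/d]≡n d∣t)))
  (gcd[cm,cn]/c≡gcd[m,n] d (m / d) (t / d)))
  where
  d*[n/d]≡n : ∀ {n} → d ∣ n → d *ℕ (n / d) ≡ n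
  d*[n/d]≡n {n} d∣n = ≡.trans (ℕ.*-comm d (n / d)) (m/n*n≡m d∣n)

module DivisorSums {c ℓ} (S : CommutativeSemiring c ℓ) where
  open CommutativeSemiring S
  open FiniteSums S
  open import Algebra.Properties.CommutativeSemigroup *-commutativeSemigroup
    using () renaming (x∙yz≈y∙xz to x*yz≈y*xz)
  open import Algebra.Solver.CommutativeMonoid *-commutativeMonoid using (solve; _⊕_; _⊜_)
  open import Relation.Binary.Reasoning.Setoid setoid

  ArithFun : Set c
  ArithFun = (d : ℕ) → .{{_ : NonZero d}} → Carrier

  Σ∣ : ℕ → ArithFun → Carrier
  Σ∣ n f = Σ n (λ k → [ suc k ∣? n ] * f (suc k))

  Σ∣-cong : ∀ n {f g : ArithFun} → (∀ d .{{_ : NonZero d}} → d ∣ n → f d ≈ g d) → Σ∣ n f ≈ Σ∣ n g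
  Σ∣-cong n f≈g = Σ-cong n (λ k _ → []*-cong (suc k ∣? n) (f≈g (suc k)))

  Σ∣-head : ∀ n .{{_ : NonZero n}} (f : ArithFun) →
    Σ∣ n f ≈ f 1 + Σ (pred n) (λ k → [ suc (suc k) ∣? n ] * f (suc (suc k)))
  Σ∣-head (suc n) f = +-congʳ ([yes]* (1 ∣? suc n) (1∣ suc n) (f 1))

  Σ-multiples : ∀ d′ q (h : ℕ → Carrier) →
    Σ (q *ℕ suc d′) (λ K → [ suc d′ ∣? suc K ] * h (suc K)) ≈ Σ q (λ j → h (suc d′ *ℕ suc j))
  Σ-multiples d′ zero    h = refl
  Σ-multiples d′ (suc q) h = begin
    Σ (d +ℕ q *ℕ d) f                                ≈⟨ Σ-split d (q *ℕ d) f ⟩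
    Σ d f + Σ (q *ℕ d) (λ i → f (d +ℕ i))            ≈⟨ +-cong first-block later-blocks ⟩
    h d + Σ q (λ j → h (d +ℕ d *ℕ suc j))            ≈⟨ +-cong (reflexive (≡.cong h (≡.sym (ℕ.*-identityʳ d))))
                                                          (Σ-cong q (λ j _ → reflexive (≡.cong h (≡.sym (ℕ.*-suc d (suc j)))))) ⟩
    Σ (suc q) (λ j → h (d *ℕ suc j))                 ∎
    where
    d = suc d′
    f : ℕ → Carrier
    f K = [ d ∣? suc K ] * h (suc K)
    -- in the first block 1, …, d only K = d is a multiple of d
    first-block : Σ d f ≈ h d
    first-block = trans
      (Σ-single d f d′ ℕ.≤-refl (λ i i<d i≢d′ → [no]* (d ∣? suc i)
        (λ d∣i+1 → i≢d′ (ℕ.≤-antisym (ℕ.≤-pred i<d) (ℕ.≤-pred (∣⇒≤ d∣i+1)))) _))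
      ([yes]* (d ∣? d) ∣-refl _)
    shift : ∀ i → f (d +ℕ i) ≈ [ d ∣? suc i ] * h (d +ℕ suc i)
    shift i = *-cong
      ([]-cong (d ∣? suc (d +ℕ i)) (d ∣? suc i)
        (λ d∣ → ∣m+n∣m⇒∣n (≡.subst (d ∣_) (≡.sym (ℕ.+-suc d i)) d∣) ∣-refl)
        (λ d∣ → ≡.subst (d ∣_) (ℕ.+-suc d i) (∣m∣n⇒∣m+n ∣-refl d∣)))
      (reflexive (≡.cong h (≡.sym (ℕ.+-suc d i))))
    later-blocks : Σ (q *ℕ d) (λ i → f (d +ℕ i)) ≈ Σ q (λ j → h (d +ℕ d *ℕ suc j))
    later-blocks = trans (Σ-cong (q *ℕ d) (λ i _ → shift i)) (Σ-multiples d′ q (λ K → h (d +ℕ K)))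

  extend : ArithFun → ℕ → Carrier
  extend f zero    = 0#
  extend f (suc k) = f (suc k)

  Σ∣-multiples : ∀ d′ q (f : ArithFun) →
    Σ∣ (q *ℕ suc d′) (λ K → [ suc d′ ∣? K ] * f K) ≈ Σ∣ q (λ j → f (suc d′ *ℕ j) {{ℕ.m*n≢0 (suc d′) j}})
  Σ∣-multiples d′ q f = begin
    Σ n (λ K → [ suc K ∣? n ] * ([ d ∣? suc K ] * f (suc K)))
      ≈⟨ Σ-cong n (λ K _ → x*yz≈y*xz [ suc K ∣? n ] [ d ∣? suc K ] (f (suc K))) ⟩
    Σ n (λ K → [ d ∣? suc K ] * ([ suc K ∣? n ] * f (suc K)))
      ≈⟨ Σ-multiples d′ q (λ K → [ K ∣? n ] * extend f K) ⟩
    Σ q (λ j → [ d *ℕ suc j ∣? n ] * f (d *ℕ suc j))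
      ≈⟨ Σ-cong q (λ j _ → *-congʳ {x = f (d *ℕ suc j)}
           ([]-cong (d *ℕ suc j ∣? n) (suc j ∣? q) (cancel j) (scale j))) ⟩
    Σ q (λ j → [ suc j ∣? q ] * f (d *ℕ suc j)) ∎
    where
    d = suc d′
    n = q *ℕ d
    cancel : ∀ j → d *ℕ suc j ∣ n → suc j ∣ q
    cancel j dj∣n = *-cancelˡ-∣ d (≡.subst (d *ℕ suc j ∣_) (ℕ.*-comm q d) dj∣n)
    scale : ∀ j → suc j ∣ q → d *ℕ suc j ∣ n
    scale j j∣q = ≡.subst (d *ℕ suc j ∣_) (ℕ.*-comm d q) (*-monoʳ-∣ d j∣q)

  Σ∣-restrict : ∀ n K .{{_ : NonZero n}} .{{_ : NonZero K}} (f : ArithFun) → K ∣ n →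
    Σ∣ n (λ d → [ d ∣? K ] * f d) ≈ Σ∣ K f
  Σ∣-restrict n K f K∣n = trans
    (Σ-cong n (λ k _ → absorb k))
    (Σ-truncate K n (λ k → [ suc k ∣? K ] * f (suc k)) (∣⇒≤ K∣n) beyond-K)
    where
    absorb : ∀ k → [ suc k ∣? n ] * ([ suc k ∣? K ] * f (suc k)) ≈ [ suc k ∣? K ] * f (suc k)
    absorb k with suc k ∣? K
    ... | yes k∣K = [yes]* (suc k ∣? n) (∣-trans k∣K K∣n) _
    ... | no _    = trans (*-congˡ (zeroˡ _)) (trans (zeroʳ _) (sym (zeroˡ _)))
    beyond-K : ∀ k → K ≤ k → k < n → [ suc k ∣? K ] * f (suc k) ≈ 0#
    beyond-K k K≤k _ = [no]* (suc k ∣? K) (λ k∣K → ℕ.<⇒≱ (s≤s K≤k) (∣⇒≤ k∣K)) _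

  Σ∣-+ : ∀ n (f g : ArithFun) → Σ∣ n (λ d → f d + g d) ≈ Σ∣ n f + Σ∣ n g
  Σ∣-+ n f g = trans (Σ-cong n (λ k _ → distribˡ [ suc k ∣? n ] (f (suc k)) (g (suc k))))
                     (Σ-+ n (λ k → [ suc k ∣? n ] * f (suc k)) (λ k → [ suc k ∣? n ] * g (suc k)))

  Σ∣-zero : ∀ n → Σ∣ n (λ _ → 0#) ≈ 0#
  Σ∣-zero n = Σ-zero n (λ k _ → zeroʳ [ suc k ∣? n ])

  Σ∣-coprime : ∀ {p} q .{{_ : NonZero q}} → Prime p → (f : ArithFun) →
    Σ∣ (q *ℕ p) (λ d → [ ¬? (p ∣? d) ] * f d) ≈ Σ∣ q (λ d → [ ¬? (p ∣? d) ] * f d)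
  Σ∣-coprime {p} q pp f = trans
    (Σ-cong (q *ℕ p) (λ k _ → reduce k))
    (Σ-truncate q (q *ℕ p) (λ k → [ suc k ∣? q ] * ([ ¬? (p ∣? suc k) ] * f (suc k)))
      (ℕ.m≤m*n q p) beyond-q)
    where
    instance _ = prime⇒nonZero pp
    g : ℕ → Carrier
    g k = [ ¬? (p ∣? suc k) ] * f (suc k)
    coprime : ∀ k → ¬ p ∣ suc k → Coprime (suc k) p
    coprime k p∤k {i} (i∣k , i∣p) with prime⇒irreducible pp i∣p
    ... | inj₁ i≡1   = i≡1
    ... | inj₂ ≡.refl = contradiction i∣k p∤k
    reduce : ∀ k → [ suc k ∣? q *ℕ p ] * g k ≈ [ suc k ∣? q ] * g k
    reduce k with p ∣? suc k
    ... | yes _   = trans (annihilate _ (f (suc k))) (sym (annihilate _ (f (suc k))))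
      where annihilate : ∀ x y → x * (0# * y) ≈ 0#
            annihilate x y = trans (*-congˡ (zeroˡ y)) (zeroʳ x)
    ... | no p∤k = *-congʳ ([]-cong (suc k ∣? q *ℕ p) (suc k ∣? q)
        (λ k∣qp → coprime-divisor (coprime k p∤k) (≡.subst (suc k ∣_) (ℕ.*-comm q p) k∣qp))
        (λ k∣q → ∣m⇒∣m*n p k∣q))
    beyond-q : ∀ k → q ≤ k → k < q *ℕ p → [ suc k ∣? q ] * g k ≈ 0#
    beyond-q k q≤k _ = [no]* (suc k ∣? q) (λ k∣q → ℕ.<⇒≱ (s≤s q≤k) (∣⇒≤ k∣q)) _

  Σ∣-*ˡ : ∀ n x (f : ArithFun) → x * Σ∣ n f ≈ Σ∣ n (λ d → x * f d)
  Σ∣-*ˡ n x f = trans (Σ-*ˡ n x (λ k → [ suc k ∣? n ] * f (suc k)))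
                      (Σ-cong n (λ k _ → x*yz≈y*xz x [ suc k ∣? n ] (f (suc k))))

  Σ∣-swap : ∀ n (f w : ArithFun) →
    Σ∣ n (λ d → f d * Σ∣ n (λ K → [ d ∣? K ] * w K)) ≈
    Σ∣ n (λ K → w K * Σ∣ n (λ d → [ d ∣? K ] * f d))
  Σ∣-swap n f w = begin
    Σ n (λ k → [ suc k ∣? n ] * (f (suc k) * Σ n (λ j → [ suc j ∣? n ] * ([ suc k ∣? suc j ] * w (suc j)))))
      ≈⟨ Σ-cong n (λ k _ → expand k) ⟩
    Σ n (λ k → Σ n (λ j → F k j))
      ≈⟨ Σ-swap n n F ⟩
    Σ n (λ j → Σ n (λ k → F k j))
      ≈⟨ Σ-cong n (λ j _ → sym (collect j)) ⟩
    Σ n (λ j → [ suc j ∣? n ] * (w (suc j) * Σ n (λ k → [ suc k ∣? n ] * ([ suc k ∣? suc j ] * f (suc k))))) ∎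
    where
    F : ℕ → ℕ → Carrier
    F k j = [ suc k ∣? n ] * (f (suc k) * ([ suc j ∣? n ] * ([ suc k ∣? suc j ] * w (suc j))))
    rearrange : ∀ a b c d e → a * (b * (c * (d * e))) ≈ c * (e * (a * (d * b)))
    rearrange = solve 5 (λ a b c d e → a ⊕ (b ⊕ (c ⊕ (d ⊕ e))) ⊜ c ⊕ (e ⊕ (a ⊕ (d ⊕ b)))) refl
    expand : ∀ k → [ suc k ∣? n ] * (f (suc k) * Σ n (λ j → [ suc j ∣? n ] * ([ suc k ∣? suc j ] * w (suc j))))
                 ≈ Σ n (λ j → F k j)
    expand k = trans (*-congˡ (Σ-*ˡ n (f (suc k)) (λ j → [ suc j ∣? n ] * ([ suc k ∣? suc j ] * w (suc j)))))
                     (Σ-*ˡ n [ suc k ∣? n ] (λ j → f (suc k) * ([ suc j ∣? n ] * ([ suc k ∣? suc j ] * w (suc j)))))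
    collect : ∀ j → [ suc j ∣? n ] * (w (suc j) * Σ n (λ k → [ suc k ∣? n ] * ([ suc k ∣? suc j ] * f (suc k))))
                  ≈ Σ n (λ k → F k j)
    collect j = trans (*-congˡ (Σ-*ˡ n (w (suc j)) (λ k → [ suc k ∣? n ] * ([ suc k ∣? suc j ] * f (suc k)))))
      (trans (Σ-*ˡ n [ suc j ∣? n ] (λ k → w (suc j) * ([ suc k ∣? n ] * ([ suc k ∣? suc j ] * f (suc k)))))
        (Σ-cong n (λ k _ → sym (rearrange [ suc k ∣? n ] (f (suc k)) [ suc j ∣? n ] [ suc k ∣? suc j ] (w (suc j))))))

module Möbius {c ℓ} (R : CommutativeRing c ℓ) where
  open CommutativeRing R
  open import Algebra.Properties.Ring ring using (-0#≈0#; -‿involutive)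
  open FiniteSums commutativeSemiring
  open DivisorSums commutativeSemiring
  open import Relation.Binary.Reasoning.Setoid setoid

  μR : ℕ → Carrier
  μR d = fromℤ R (μ d)

  fromℤ-neg : ∀ z → fromℤ R (ℤ.- z) ≈ - fromℤ R z
  fromℤ-neg (+ zero)  = sym -0#≈0#
  fromℤ-neg (+ suc n) = refl
  fromℤ-neg -[1+ n ]  = sym (-‿involutive _)

  μR-prime-mul : ∀ {p} n .{{_ : NonZero n}} → Prime p → μR (p *ℕ n) ≈ - ([ ¬? (p ∣? n) ] * μR n)
  μR-prime-mul {p} n pp with p ∣? n
  ... | yes p∣n = trans (reflexive (≡.cong (fromℤ R) (μ-prime-mul-∣ n pp p∣n)))
                        (sym (trans (-‿cong (zeroˡ (μR n))) -0#≈0#))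
  ... | no p∤n  = trans (reflexive (≡.cong (fromℤ R) (μ-prime-mul n pp p∤n)))
                        (trans (fromℤ-neg (μ n)) (-‿cong (sym (*-identityˡ (μR n)))))

  -- Σ_{d ∣ q·p} μ(d) = 0 for a prime p: the divisors p·e cancel the divisors e with p ∤ e
  Σ∣-μ-prime-mul : ∀ {p} q .{{_ : NonZero q}} → Prime p → Σ∣ (q *ℕ p) (λ d → μR d) ≈ 0#
  Σ∣-μ-prime-mul {p@(suc p′)} q pp = begin
    Σ∣ (q *ℕ p) (λ d → μR d)
      ≈⟨ Σ∣-cong (q *ℕ p) (λ d _ → []-split (p ∣? d) (μR d)) ⟩
    Σ∣ (q *ℕ p) (λ d → [ p ∣? d ] * μR d + [ ¬? (p ∣? d) ] * μR d)
      ≈⟨ Σ∣-+ (q *ℕ p) (λ d → [ p ∣? d ] * μR d) (λ d → [ ¬? (p ∣? d) ] * μR d) ⟩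
    Σ∣ (q *ℕ p) (λ d → [ p ∣? d ] * μR d) + Σ∣ (q *ℕ p) (λ d → coprimePart d)
      ≈⟨ +-cong (Σ∣-multiples p′ q (λ d → μR d)) (Σ∣-coprime q pp (λ d → μR d)) ⟩
    Σ∣ q (λ e → μR (p *ℕ e)) + Σ∣ q (λ e → coprimePart e)
      ≈⟨ +-congʳ (Σ∣-cong q (λ e _ → μR-prime-mul e pp)) ⟩
    Σ∣ q (λ e → - coprimePart e) + Σ∣ q (λ e → coprimePart e)
      ≈⟨ sym (Σ∣-+ q (λ e → - coprimePart e) (λ e → coprimePart e)) ⟩
    Σ∣ q (λ e → - coprimePart e + coprimePart e)
      ≈⟨ Σ∣-cong q (λ e _ → -‿inverseˡ (coprimePart e)) ⟩
    Σ∣ q (λ _ → 0#)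
      ≈⟨ Σ∣-zero q ⟩
    0# ∎
    where
    coprimePart : ℕ → Carrier
    coprimePart d = [ ¬? (p ∣? d) ] * μR d

  μR-1 : μR 1 ≈ 1#
  μR-1 = +-identityʳ 1#

  Σ∣-μ-1 : Σ∣ 1 (λ d → μR d) ≈ 1#
  Σ∣-μ-1 = trans (+-identityʳ _) (trans (*-identityˡ _) (+-identityʳ 1#))

  -- Σ_{d ∣ n} μ(d) = 0 for n ≥ 2, using any prime factor of n
  Σ∣-μ : ∀ n → 2 ≤ n → Σ∣ n (λ d → μR d) ≈ 0#
  Σ∣-μ (suc zero) (s≤s ())
  Σ∣-μ n@(suc (suc _)) _ with factorise n
  ... | record { factors = [] ; isFactorisation = () }
  ... | record { factors = p ∷ ps ; isFactorisation = n≡p*q ; factorsPrime = pp ∷ psPrime } =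
    trans (reflexive (≡.cong (λ m → Σ∣ m (λ d → μR d)) (≡.trans n≡p*q (ℕ.*-comm p q))))
          (Σ∣-μ-prime-mul q pp)
    where
    q = product ps
    instance _ = productOfPrimes≢0 psPrime

module TwistedTransforms {c ℓ} (R : CommutativeRing c ℓ) where
  open CommutativeRing R
  open import Algebra.Properties.Ring ring using (-‿distribˡ-*; -‿involutive; +-cancelʳ)
  open FiniteSums commutativeSemiring
  open DivisorSums commutativeSemiring
  open Möbius R
  open import Algebra.Properties.CommutativeSemigroup *-commutativeSemigroup
    using () renaming (x∙yz≈y∙xz to x*yz≈y*xz)
  open import Relation.Binary.Reasoning.Setoid setoid

  ε : ℕ → ArithFun
  ε t d = negOnePow R (signExp R t d)

  negOnePow-+ : ∀ a b → negOnePow R (a +ℕ b) ≈ negOnePow R a * negOnePow R b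
  negOnePow-+ zero    b = sym (*-identityˡ _)
  negOnePow-+ (suc a) b = trans (-‿cong (negOnePow-+ a b)) (-‿distribˡ-* _ _)

  negOnePow-double : ∀ a → negOnePow R (a +ℕ a) ≈ 1#
  negOnePow-double zero    = refl
  negOnePow-double (suc a) =
    trans (reflexive (≡.cong (λ k → negOnePow R (suc k)) (ℕ.+-suc a a)))
          (trans (-‿involutive _) (negOnePow-double a))

  -- the trivial divisor has sign ε(t, 1) = (-1)^{2t} = 1
  ε-1 : ∀ t → ε t 1 ≈ 1#
  ε-1 t = trans (reflexive (≡.cong (negOnePow R) exponent)) (negOnePow-double t)
    where
    exponent : (t / 1) *ℕ 2 ≡ t +ℕ t
    exponent = ≡.trans (≡.cong (_*ℕ 2) (n/1≡n t))
                       (≡.trans (ℕ.*-comm t 2) (≡.cong (t +ℕ_) (ℕ.+-identityʳ t)))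

  ε-cocycle : ∀ t d e .{{_ : NonZero d}} .{{_ : NonZero e}} → d *ℕ e ∣ t →
    ε t d * ε (t / d) e ≈ ε t (d *ℕ e) {{ℕ.m*n≢0 d e}}
  ε-cocycle t d e de∣t = begin
    negOnePow R ((t / d) *ℕ suc d) * negOnePow R ((t / d / e) *ℕ suc e)
      ≈⟨ *-cong (reflexive (≡.cong (λ k → negOnePow R (k *ℕ suc d)) (/-factor t d e de∣t)))
                (reflexive (≡.cong (λ k → negOnePow R (k *ℕ suc e)) (m/n/o≡m/[n*o] t d e))) ⟩
    negOnePow R ((u *ℕ e) *ℕ suc d) * negOnePow R (u *ℕ suc e)
      ≈⟨ negOnePow-+ ((u *ℕ e) *ℕ suc d) (u *ℕ suc e) ⟨
    negOnePow R ((u *ℕ e) *ℕ suc d +ℕ u *ℕ suc e)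
      ≈⟨ reflexive (≡.cong (negOnePow R) (exponents u d e)) ⟩
    negOnePow R (u *ℕ suc (d *ℕ e) +ℕ (u *ℕ e +ℕ u *ℕ e))
      ≈⟨ negOnePow-+ (u *ℕ suc (d *ℕ e)) (u *ℕ e +ℕ u *ℕ e) ⟩
    negOnePow R (u *ℕ suc (d *ℕ e)) * negOnePow R (u *ℕ e +ℕ u *ℕ e)
      ≈⟨ trans (*-congˡ (negOnePow-double (u *ℕ e))) (*-identityʳ _) ⟩
    negOnePow R (u *ℕ suc (d *ℕ e)) ∎
    where
    instance _ = ℕ.m*n≢0 d e
    u = t / (d *ℕ e)
    exponents : ∀ u d e → (u *ℕ e) *ℕ suc d +ℕ u *ℕ suc e ≡ u *ℕ suc (d *ℕ e) +ℕ (u *ℕ e +ℕ u *ℕ e)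
    exponents = solve-∀

  sumDivisors≈Σ∣ : ∀ n (f : ArithFun) → sumDivisors R n f ≈ Σ∣ n f
  sumDivisors≈Σ∣ n f = foldr-filter (λ k → suc k ∣? n) (λ k → f (suc k)) (λ i → i) n

  plain : (ℕ → ℕ → Carrier) → ℕ → ℕ → Carrier
  plain Z m t = sumDivisors R (gcd m t) (λ d → ε t d * Z (m / d) (t / d))

  term : ArithFun → (ℕ → ℕ → Carrier) → ℕ → ℕ → ArithFun
  term f Z m t d = ε t d * (f d * Z (m / d) (t / d))

  term-cong : ∀ f {A B : ℕ → ℕ → Carrier} m t d .{{_ : NonZero d}} →
    A (m / d) (t / d) ≈ B (m / d) (t / d) → term f A m t d ≈ term f B m t d
  term-cong f m t d eq = *-congˡ {ε t d} (*-congˡ {f d} eq)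

  twisted : ArithFun → (ℕ → ℕ → Carrier) → ℕ → ℕ → Carrier
  twisted f Z m t = sumDivisors R (gcd m t) (term f Z m t)

  _≈⁺_ : (A B : ℕ → ℕ → Carrier) → Set ℓ
  A ≈⁺ B = ∀ m t → 1 ≤ m → 1 ≤ t → A m t ≈ B m t

  twisted-cong : ∀ f {A B} → A ≈⁺ B → twisted f A ≈⁺ twisted f B
  twisted-cong f {A} {B} A≈B m t m≥1 t≥1 = begin
    twisted f A m t        ≈⟨ sumDivisors≈Σ∣ (gcd m t) (term f A m t) ⟩
    Σ∣ (gcd m t) (term f A m t) ≈⟨ Σ∣-cong (gcd m t) (λ d d∣g → term-cong f {A} {B} m t d (A≈B _ _
                                      (/-positive m d m≥1 (∣-trans d∣g (gcd[m,n]∣m m t)))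
                                      (/-positive t d t≥1 (∣-trans d∣g (gcd[m,n]∣n m t))))) ⟩
    Σ∣ (gcd m t) (term f B m t) ≈⟨ sumDivisors≈Σ∣ (gcd m t) (term f B m t) ⟨
    twisted f B m t        ∎

  rest : ArithFun → (ℕ → ℕ → Carrier) → ℕ → ℕ → Carrier
  rest f Z m t = Σ (pred (gcd m t)) (λ k → [ suc (suc k) ∣? gcd m t ] * term f Z m t (suc (suc k)))

  twisted-head : ∀ f Z m t .{{_ : NonZero m}} → twisted f Z m t ≈ f 1 * Z m t + rest f Z m t
  twisted-head f Z m t = trans (sumDivisors≈Σ∣ (gcd m t) (term f Z m t))
                               (trans (Σ∣-head (gcd m t) (term f Z m t)) (+-congʳ first))
    where
    instance _ = gcd-nonZero m t
    first : term f Z m t 1 ≈ f 1 * Z m t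
    first = trans (*-cong (ε-1 t) (*-congˡ (reflexive (≡.cong₂ Z (n/1≡n m) (n/1≡n t)))))
                  (*-identityˡ _)

  twisted-identity : ∀ f → f 1 ≈ 1# → (∀ n .{{_ : NonZero n}} → 2 ≤ n → f n ≈ 0#) →
    ∀ Z → twisted f Z ≈⁺ Z
  twisted-identity f f1≈1 f≈0 Z m t m≥1 _ = begin
    twisted f Z m t             ≈⟨ twisted-head f Z m t ⟩
    f 1 * Z m t + rest f Z m t  ≈⟨ +-cong (*-congʳ f1≈1) (Σ-zero (pred (gcd m t)) (λ k _ → vanish k)) ⟩
    1# * Z m t + 0#             ≈⟨ trans (+-identityʳ _) (*-identityˡ _) ⟩
    Z m t                       ∎
    where
    instance _ = ℕ.>-nonZero m≥1
    vanish : ∀ k → [ suc (suc k) ∣? gcd m t ] * term f Z m t (suc (suc k)) ≈ 0#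
    vanish k = trans (*-congˡ (trans (*-congˡ (trans (*-congʳ (f≈0 (suc (suc k)) (s≤s (s≤s z≤n))))
                                                    (zeroˡ _)))
                                     (zeroʳ _)))
                     (zeroʳ _)

  -- a weight with f(1) = 1 makes the transform unitriangular, hence injective:
  -- by strong induction on m, since the other terms only involve Z(m/d, ·) with d ≥ 2
  twisted-injective : ∀ f → f 1 ≈ 1# → ∀ {A B} → twisted f A ≈⁺ twisted f B → A ≈⁺ B
  twisted-injective f f1≈1 {A} {B} TA≈TB m = <-rec Agree step m
    where
    Agree : ℕ → Set _
    Agree m = ∀ t → 1 ≤ m → 1 ≤ t → A m t ≈ B m t
    step : ∀ m → (∀ {m′} → m′ < m → Agree m′) → Agree m
    step m ih t m≥1 t≥1 = +-cancelʳ (rest f B m t) (A m t) (B m t) (begin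
      A m t + rest f B m t        ≈⟨ +-cong (unit (A m t)) (sym rest-agree) ⟩
      f 1 * A m t + rest f A m t  ≈⟨ twisted-head f A m t ⟨
      twisted f A m t             ≈⟨ TA≈TB m t m≥1 t≥1 ⟩
      twisted f B m t             ≈⟨ twisted-head f B m t ⟩
      f 1 * B m t + rest f B m t  ≈⟨ +-congʳ (unit (B m t)) ⟨
      B m t + rest f B m t        ∎)
      where
      instance _ = ℕ.>-nonZero m≥1
      unit : ∀ x → x ≈ f 1 * x
      unit x = sym (trans (*-congʳ f1≈1) (*-identityˡ x))
      rest-agree : rest f A m t ≈ rest f B m t
      rest-agree = Σ-cong (pred (gcd m t)) λ k _ → []*-cong (suc (suc k) ∣? gcd m t) λ d∣g →
        term-cong f {A} {B} m t (suc (suc k)) (ih (m/n<m m (suc (suc k)) (s≤s (s≤s z≤n))) (t / suc (suc k))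
          (/-positive m (suc (suc k)) m≥1 (∣-trans d∣g (gcd[m,n]∣m m t)))
          (/-positive t (suc (suc k)) t≥1 (∣-trans d∣g (gcd[m,n]∣n m t))))

  -- composing with the unweighted transform convolves the weight with the constant 1:
  -- the pair (d, e) with e ∣ gcd/d contributes to K = d·e, and ε(t,d) ε(t/d,e) = ε(t,K)
  twisted-plain : ∀ f Z m t .{{_ : NonZero m}} →
    twisted f (plain Z) m t ≈ twisted (λ K → Σ∣ K f) Z m t
  twisted-plain f Z m t = begin
    twisted f (plain Z) m t
      ≈⟨ sumDivisors≈Σ∣ g (term f (plain Z) m t) ⟩
    Σ∣ g (term f (plain Z) m t)
      ≈⟨ Σ∣-cong g inner ⟩
    Σ∣ g (λ d → f d * Σ∣ g (λ K → [ d ∣? K ] * W K))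
      ≈⟨ Σ∣-swap g f W ⟩
    Σ∣ g (λ K → W K * Σ∣ g (λ d → [ d ∣? K ] * f d))
      ≈⟨ Σ∣-cong g (λ K K∣g → *-congˡ {W K} (Σ∣-restrict g K f K∣g)) ⟩
    Σ∣ g (λ K → W K * Σ∣ K f)
      ≈⟨ Σ∣-cong g (λ K _ → *-assoc (ε t K) (Z (m / K) (t / K)) (Σ∣ K f)) ⟩
    Σ∣ g (λ K → ε t K * (Z (m / K) (t / K) * Σ∣ K f))
      ≈⟨ Σ∣-cong g (λ K _ → *-congˡ {ε t K} (*-comm (Z (m / K) (t / K)) (Σ∣ K f))) ⟩
    Σ∣ g (term (λ K → Σ∣ K f) Z m t)
      ≈⟨ sumDivisors≈Σ∣ g (term (λ K → Σ∣ K f) Z m t) ⟨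
    twisted (λ K → Σ∣ K f) Z m t ∎
    where
    g = gcd m t
    instance _ = gcd-nonZero m t
    W : ArithFun
    W K = ε t K * Z (m / K) (t / K)
    -- the inner transform at (m/d, t/d), rewritten as a sum over the multiples K of d
    inner : ∀ d .{{_ : NonZero d}} → d ∣ g → term f (plain Z) m t d ≈ f d * Σ∣ g (λ K → [ d ∣? K ] * W K)
    inner d@(suc d′) d∣g = begin
      ε t d * (f d * plain Z (m / d) (t / d))
        ≈⟨ x*yz≈y*xz (ε t d) (f d) (plain Z (m / d) (t / d)) ⟩
      f d * (ε t d * plain Z (m / d) (t / d))
        ≈⟨ *-congˡ (*-congˡ (sumDivisors≈Σ∣ (gcd (m / d) (t / d)) G)) ⟩
      f d * (ε t d * Σ∣ (gcd (m / d) (t / d)) G)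
        ≈⟨ *-congˡ (*-congˡ (reflexive (≡.cong (λ n → Σ∣ n G) (gcd-/ m t d d∣m d∣t)))) ⟩
      f d * (ε t d * Σ∣ q G)
        ≈⟨ *-congˡ (Σ∣-*ˡ q (ε t d) G) ⟩
      f d * Σ∣ q (λ e → ε t d * G e)
        ≈⟨ *-congˡ (Σ∣-cong q merge) ⟩
      f d * Σ∣ q (λ e → W (d *ℕ e) {{ℕ.m*n≢0 d e}})
        ≈⟨ *-congˡ (Σ∣-multiples d′ q W) ⟨
      f d * Σ∣ (q *ℕ d) (λ K → [ d ∣? K ] * W K)
        ≈⟨ *-congˡ (reflexive (≡.cong (λ n → Σ∣ n (λ K → [ d ∣? K ] * W K)) (m/n*n≡m d∣g))) ⟩
      f d * Σ∣ g (λ K → [ d ∣? K ] * W K) ∎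
      where
      q = g / d
      d∣m = ∣-trans d∣g (gcd[m,n]∣m m t)
      d∣t = ∣-trans d∣g (gcd[m,n]∣n m t)
      G : ArithFun
      G e = ε (t / d) e * Z (m / d / e) (t / d / e)
      merge : ∀ e .{{_ : NonZero e}} → e ∣ q → ε t d * G e ≈ W (d *ℕ e) {{ℕ.m*n≢0 d e}}
      merge e e∣q = trans (sym (*-assoc _ _ _))
        (*-cong (ε-cocycle t d e de∣t)
                (reflexive (≡.cong₂ Z (m/n/o≡m/[n*o] m d e) (m/n/o≡m/[n*o] t d e))))
        where
        instance _ = ℕ.m*n≢0 d e
        de∣t : d *ℕ e ∣ t
        de∣t = ∣-trans (≡.subst₂ _∣_ (ℕ.*-comm e d) (m/n*n≡m d∣g) (*-monoˡ-∣ d e∣q)) (gcd[m,n]∣n m t)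

  multiply-by-unit : ∀ {a b x y} → a * b ≈ 1# → x ≈ b * y → a * x ≈ y
  multiply-by-unit {a} {b} {x} {y} ab≈1 x≈by = begin
    a * x        ≈⟨ *-congˡ x≈by ⟩
    a * (b * y)  ≈⟨ *-assoc a b y ⟨
    a * b * y    ≈⟨ *-congʳ ab≈1 ⟩
    1# * y       ≈⟨ *-identityˡ y ⟩
    y            ∎

  divide-by-unit : ∀ {a b x y} → a * b ≈ 1# → a * x ≈ y → x ≈ b * y
  divide-by-unit {a} {b} {x} {y} ab≈1 ax≈y = begin
    x            ≈⟨ *-identityˡ x ⟨
    1# * x       ≈⟨ *-congʳ (trans (*-comm b a) ab≈1) ⟨
    b * a * x    ≈⟨ *-assoc b a x ⟩
    b * (a * x)  ≈⟨ *-congˡ ax≈y ⟩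
    b * y        ∎

  möbius-inversion : ∀ Z → twisted (λ d → μR d) (plain Z) ≈⁺ Z
  möbius-inversion Z m t m≥1 t≥1 = trans
    (twisted-plain (λ d → μR d) Z m t)
    (twisted-identity (λ K → Σ∣ K (λ d → μR d)) Σ∣-μ-1 (λ n n≥2 → Σ∣-μ n n≥2) Z m t m≥1 t≥1)
    where instance _ = ℕ.>-nonZero m≥1

proposition11 : ∀ {c ℓ} (R : CommutativeRing c ℓ) →
    let open CommutativeRing R in
    (inv : ℕ → Carrier) →
    (∀ m → 1 ≤ m → fromℕ R m * inv m ≈ 1#) →
    (X Y : ℕ → ℕ → Carrier) →
    ((∀ m t → 1 ≤ m → 1 ≤ t → Y m t ≈ transformY R X m t)
    ⇔ (∀ m t → 1 ≤ m → 1 ≤ t → X m t ≈ inv m * transformX R Y m t))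
proposition11 R inv m*inv≈1 X Y = mk⇔ forward backward
  where
  open CommutativeRing R
  open Möbius R using (μR; μR-1)
  open TwistedTransforms R

  Z : ℕ → ℕ → Carrier
  Z m t = fromℕ R m * X m t

  forward : Y ≈⁺ plain Z → X ≈⁺ (λ m t → inv m * twisted (λ d → μR d) Y m t)
  forward Y≈plainZ m t m≥1 t≥1 = divide-by-unit (m*inv≈1 m m≥1) (sym (trans
    (twisted-cong (λ d → μR d) Y≈plainZ m t m≥1 t≥1) (möbius-inversion Z m t m≥1 t≥1)))

  backward : X ≈⁺ (λ m t → inv m * twisted (λ d → μR d) Y m t) → Y ≈⁺ plain Z
  backward X≈invμY = twisted-injective (λ d → μR d) μR-1 λ m t m≥1 t≥1 → trans
    (sym (multiply-by-unit (m*inv≈1 m m≥1) (X≈invμY m t m≥1 t≥1)))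
    (sym (möbius-inversion Z m t m≥1 t≥1))
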